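{- Let $k$ be a positive integer. Then for every integer $n\geq 1$, $$\mathrm{LS}(n+k,n)=2^k\sum_{t_k=1}^{n}\binom{t_k+1}{2}\sum_{t_{k-1}=1}^{t_k}\binom{t_{k-1}+1}{2}\cdots\sum_{t_2=1}^{t_3}\binom{t_2+1}{2}\sum_{t_1=1}^{t_2}\binom{t_1+1}{2},$$ i.e. $\mathrm{LS}(n+k,n)=2^k\sum_{1\le t_1\le t_2\le\cdots\le t_k\le n}\prod_{\ell=1}^k\binom{t_\ell+1}{2}$.
   Context: The Legendre-Stirling numbers of the second kind $\mathrm{LS}(n,k)$ ($n,k\ge 0$) are defined by the recurrence $\mathrm{LS}(n,k)=\mathrm{LS}(n-1,k-1)+k(k+1)\mathrm{LS}(n-1,k)$ with initial conditions $\mathrm{LS}(n,0)=\delta_{n,0}$ and $\mathrm{LS}(0,k)=\delta_{0,k}$. -}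

module Defs where

open import Data.Nat using (ℕ; zero; suc; _+_; _*_)
open import Data.Nat.Combinatorics using (_C_)

LS : ℕ → ℕ → ℕ
LS zero    zero    = 1
LS zero    (suc k) = 0
LS (suc n) zero    = 0
LS (suc n) (suc k) = LS n k + (suc k * suc (suc k)) * LS n (suc k)

sumFrom1 : ℕ → (ℕ → ℕ) → ℕ
sumFrom1 zero    f = 0
sumFrom1 (suc n) f = sumFrom1 n f + f (suc n)

-- Nested sum: nested 0 n = 1,
-- nested (k+1) n = Σ_{t=1}^{n} C(t+1,2) · nested k t,
-- i.e. nested k n = Σ_{1≤t_1≤…≤t_k≤n} Π_ℓ C(t_ℓ+1,2).
nested : ℕ → ℕ → ℕ
nested zero    n = 1
nested (suc k) n = sumFrom1 n (λ t → (suc t C 2) * nested k t)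

-- Both sides, as functions of (k, n), satisfy the Legendre-Stirling recurrence read along the
-- diagonal: f (k+1) (n+1) = f (k+1) n + (n+1)(n+2) f k (n+1), because 2 C(n+2,2) = (n+1)(n+2)
-- absorbs one factor 2 and the last summand of the outer sum of nested. The boundary values
-- agree too: LS(n,n) = 1 = nested 0 n and LS(k,0) = 0 = nested k 0 for k ≥ 1.
module Submission where

open import Defs
open import Data.Nat using (ℕ; zero; suc; _+_; _*_; _^_; _≤_; _<_; s<s)
open import Data.Nat.Properties using (+-suc; +-identityʳ; *-zeroʳ; *-comm; n<1+n; m<n⇒m<1+n)
open import Data.Nat.Combinatorics using (_C_; nCk+nC[k+1]≡[n+1]C[k+1]; nC1≡n)
open import Data.Nat.Tactic.RingSolver using (solve-∀)
open import Relation.Binary.PropositionalEquality using (_≡_; refl; sym; trans; cong; cong₂; module ≡-Reasoning)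

2*[1+n]C2≡[1+n]*n : ∀ n → 2 * (suc n C 2) ≡ suc n * n
2*[1+n]C2≡[1+n]*n zero    = refl
2*[1+n]C2≡[1+n]*n (suc n) = begin
  2 * (suc (suc n) C 2)        ≡⟨ cong (2 *_) (sym (nCk+nC[k+1]≡[n+1]C[k+1] (suc n) 1)) ⟩
  2 * (suc n C 1 + suc n C 2)  ≡⟨ cong (λ x → 2 * (x + suc n C 2)) (nC1≡n (suc n)) ⟩
  2 * (suc n + suc n C 2)      ≡⟨ double-+ (suc n) (suc n C 2) ⟩
  2 * suc n + 2 * (suc n C 2)  ≡⟨ cong (2 * suc n +_) (2*[1+n]C2≡[1+n]*n n) ⟩
  2 * suc n + suc n * n        ≡⟨ pascal-step n ⟩
  suc (suc n) * suc n          ∎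
  where
  open ≡-Reasoning
  double-+ : ∀ a b → 2 * (a + b) ≡ 2 * a + 2 * b
  double-+ = solve-∀
  pascal-step : ∀ n → 2 * suc n + suc n * n ≡ suc (suc n) * suc n
  pascal-step = solve-∀

LS-above-diagonal : ∀ {n k} → n < k → LS n k ≡ 0
LS-above-diagonal {zero}  {suc k} _          = refl
LS-above-diagonal {suc n} {suc k} (s<s n<k) = begin
  LS n k + (suc k * suc (suc k)) * LS n (suc k)
    ≡⟨ cong₂ (λ x y → x + (suc k * suc (suc k)) * y)
             (LS-above-diagonal n<k) (LS-above-diagonal (m<n⇒m<1+n n<k)) ⟩
  (suc k * suc (suc k)) * 0
    ≡⟨ *-zeroʳ (suc k * suc (suc k)) ⟩
  0 ∎
  where open ≡-Reasoning

LS-diagonal : ∀ n → LS n n ≡ 1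
LS-diagonal zero    = refl
LS-diagonal (suc n) = begin
  LS n n + (suc n * suc (suc n)) * LS n (suc n)
    ≡⟨ cong₂ (λ x y → x + (suc n * suc (suc n)) * y) (LS-diagonal n) (LS-above-diagonal (n<1+n n)) ⟩
  1 + (suc n * suc (suc n)) * 0
    ≡⟨ cong suc (*-zeroʳ (suc n * suc (suc n))) ⟩
  1 ∎
  where open ≡-Reasoning

LS[n+k,n]≡2^k*nested : ∀ k n → LS (n + k) n ≡ 2 ^ k * nested k n
LS[n+k,n]≡2^k*nested zero    n       = trans (cong (λ m → LS m n) (+-identityʳ n)) (LS-diagonal n)
LS[n+k,n]≡2^k*nested (suc k) zero    = sym (*-zeroʳ (2 ^ suc k))
LS[n+k,n]≡2^k*nested (suc k) (suc n) = begin
  LS (n + suc k) n + w * LS (n + suc k) (suc n)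
    ≡⟨ cong₂ (λ x y → x + w * y) (LS[n+k,n]≡2^k*nested (suc k) n) LS-column-sucn ⟩
  2 ^ suc k * S + w * (2 ^ k * N)
    ≡⟨ cong (λ z → 2 ^ suc k * S + z * (2 ^ k * N)) w≡2c ⟩
  2 ^ suc k * S + (2 * c) * (2 ^ k * N)
    ≡⟨ absorb-factor-2 (2 ^ k) S c N ⟩
  2 ^ suc k * (S + c * N) ∎
  where
  open ≡-Reasoning
  w = suc n * suc (suc n)
  c = suc (suc n) C 2
  S = nested (suc k) n
  N = nested k (suc n)

  w≡2c : w ≡ 2 * c
  w≡2c = trans (*-comm (suc n) (suc (suc n))) (sym (2*[1+n]C2≡[1+n]*n (suc n)))

  LS-column-sucn : LS (n + suc k) (suc n) ≡ 2 ^ k * N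
  LS-column-sucn = trans (cong (λ m → LS m (suc n)) (+-suc n k)) (LS[n+k,n]≡2^k*nested k (suc n))

  absorb-factor-2 : ∀ p S c N → (p + (p + 0)) * S + (2 * c) * (p * N) ≡ (p + (p + 0)) * (S + c * N)
  absorb-factor-2 = solve-∀

-- The identity holds for all k and n.
lemma2 : (k n : ℕ) → 1 ≤ k → 1 ≤ n →
    LS (n + k) n ≡ 2 ^ k * nested k n
lemma2 k n _ _ = LS[n+k,n]≡2^k*nested k n
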